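{- Let $\vec{G}$ be a finite directed rooted tree in which every edge is directed away from the root. Then $\operatorname{adim}(\vec{G}) = \operatorname{bdim}(\vec{G})$.
   Context: A directed rooted tree with all edges directed away from the root is a directed graph whose underlying undirected graph is a tree, with a distinguished root vertex $r$, such that every edge $uv$ is oriented from the endpoint closer to $r$ to the endpoint farther from $r$. For a finite simple directed graph $\vec{G}$ and vertices $u,v$, $d(u,v)$ is the length of a shortest directed path from $u$ to $v$, or $\infty$ if none exists; for a positive integer $k$, $d_k(u,v) := \min(d(u,v), k+1)$. A function $f : V(\vec{G}) \to \mathbb{Z}_{\geq 0}$ is a resolving broadcast of $\vec{G}$ if for any distinct $x,y \in V(\vec{G})$ there is a vertex $z$ with $f(z)>0$ such that $d_{f(z)}(z,x) \neq d_{f(z)}(z,y)$. The broadcast dimension $\operatorname{bdim}(\vec{G})$ is the minimum of $\sum_{v} f(v)$ over all resolving broadcasts $f$ of $\vec{G}$. A set $A \subseteq V(\vec{G})$ is an adjacency resolving set if for any distinct $x,y$ there is $z\in A$ with $d_1(z,x)\neq d_1(z,y)$; the adjacency dimension $\operatorname{adim}(\vec{G})$ is the minimum cardinality of such a set (equivalently, the minimum of $\sum_v f(v)$ over resolving broadcasts $f$ taking values in $\{0,1\}$). -}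

module Defs where

open import Data.Nat using (ℕ; zero; suc; _+_; _≤_; _<_; _<ᵇ_)
open import Data.Bool using (Bool; true; false; _∧_; _∨_; if_then_else_)
open import Data.Fin using (Fin; toℕ; _≟_)
open import Data.List using (List; map; allFin)
open import Data.Bool.ListAction using (any)
open import Data.Nat.ListAction using (sum)
open import Data.Product using (Σ; ∃; _×_)
open import Relation.Nullary using (¬_; does)
open import Relation.Binary.PropositionalEquality using (_≡_; _≢_)

-- A finite directed graph on vertex set Fin n: E u v ≡ true iff there is an arc u → v.
Digraph : ℕ → Set
Digraph n = Fin n → Fin n → Bool

module _ {n : ℕ} where

  reach : Digraph n → ℕ → Fin n → Fin n → Bool
  reach E zero    u v = does (u ≟ v)
  reach E (suc j) u v = reach E j u v ∨ any (λ w → reach E j u w ∧ E w v) (allFin n)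

  searchDist : Digraph n → Fin n → Fin n → ℕ → ℕ → ℕ
  searchDist E u v j zero    = j
  searchDist E u v j (suc m) = if reach E j u v then j else searchDist E u v (suc j) m

  -- Truncated distance  d_k(u,v) = min(d(u,v), k+1), where d(u,v) is the length of a
  -- shortest directed path from u to v (∞ if none).
  dtr : Digraph n → ℕ → Fin n → Fin n → ℕ
  dtr E k u v = searchDist E u v 0 (suc k)

  Reachable : Digraph n → Fin n → Fin n → Set
  Reachable E u v = ∃ λ j → reach E j u v ≡ true

  undirected : Digraph n → Digraph n
  undirected E u v = E u v ∨ E v u

  undirEdgeCount : Digraph n → ℕ
  undirEdgeCount E =
    sum (map (λ u → sum (map (λ v →
      if (toℕ u <ᵇ toℕ v) ∧ undirected E u v then 1 else 0) (allFin n))) (allFin n))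

  Loopless : Digraph n → Set
  Loopless E = ∀ u → E u u ≡ false

  UnderlyingTree : Digraph n → Set
  UnderlyingTree E = (∀ u v → Reachable (undirected E) u v) × (undirEdgeCount E + 1 ≡ n)

  -- Directed rooted tree with all edges directed away from the root r:
  -- simple digraph whose underlying undirected graph is a tree, and every arc u → v
  -- goes from the endpoint closer to r to the one farther from r (undirected distance;
  -- truncation at n is harmless since tree distances are ≤ n - 1).
  IsOutTree : Digraph n → Fin n → Set
  IsOutTree E r = Loopless E × UnderlyingTree E ×
    (∀ u v → E u v ≡ true → dtr (undirected E) n r u < dtr (undirected E) n r v)

  Broadcast : Set
  Broadcast = Fin n → ℕ

  cost : Broadcast → ℕ
  cost f = sum (map f (allFin n))

  Resolving : Digraph n → Broadcast → Set
  Resolving E f = ∀ x y → x ≢ y →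
    ∃ λ z → (0 < f z) × (dtr E (f z) z x ≢ dtr E (f z) z y)

  IsBdim : Digraph n → ℕ → Set
  IsBdim E b = (Σ Broadcast λ f → Resolving E f × cost f ≡ b)
             × (∀ f → Resolving E f → b ≤ cost f)

  VSet : Set
  VSet = Fin n → Bool

  card : VSet → ℕ
  card A = sum (map (λ v → if A v then 1 else 0) (allFin n))

  AdjResolving : Digraph n → VSet → Set
  AdjResolving E A = ∀ x y → x ≢ y →
    ∃ λ z → (A z ≡ true) × (dtr E 1 z x ≢ dtr E 1 z y)

  IsAdim : Digraph n → ℕ → Set
  IsAdim E a = (Σ VSet λ A → AdjResolving E A × card A ≡ a)
             × (∀ A → AdjResolving E A → a ≤ card A)

{-# OPTIONS --safe #-}
module Submission where

-- The indicator of an adjacency resolving set is a resolving broadcast of the same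
-- cost, so bdim ≤ adim for every digraph.  Conversely, an out-tree has n − 1 arcs
-- and every non-root vertex has a parent, so no vertex has two parents.  Given a
-- resolving broadcast f, let A be the support of f together with the hidden vertices
-- (outside the support and without a parent in it) that some z in the support
-- reaches within f z steps.  Charge such a v to a nearest such z and the distance d,
-- where 2 ≤ d ≤ f z; with unique parents every walk of length ≥ d into v passes
-- through z, so the charge is injective and |A| ≤ Σ f.  Vertices x ≠ y outside A are
-- separated at radius 1 by an active parent of one of them, since siblings are
-- equidistant from every other vertex; if neither has one, both are uncovered, so
-- every active vertex sees them at the same distance f z + 1, contradicting that f
-- resolves them.

open import Defs
open import Data.Bool using (Bool; true; false; _∧_; _∨_; not; if_then_else_)
import Data.Bool as Bool
open import Data.Bool.ListAction using (any)
open import Data.Bool.Properties using (T-≡; ∧-conicalˡ; ∧-conicalʳ; ∧-zeroʳ; ∨-zeroʳ)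
open import Data.Empty using (⊥-elim)
open import Data.Fin using (Fin; zero; suc; toℕ; fromℕ<; _≟_)
open import Data.Fin.Properties using (any?; all?; ¬∀⟶∃¬; toℕ-injective; toℕ-fromℕ<)
import Data.Fin.Properties as Fin
open import Data.List using (map; allFin; tabulate)
open import Data.List.Membership.Propositional using (lose)
open import Data.List.Membership.Propositional.Properties using (∈-allFin)
open import Data.List.Properties using (map-tabulate)
open import Data.List.Relation.Unary.Any using (satisfied)
import Data.List.Relation.Unary.Any.Properties as Any
open import Data.Nat using (ℕ; zero; suc; _+_; _∸_; _≤_; _<_; _<ᵇ_; _≤?_; _<?_; z≤n; s≤s)
import Data.Nat as ℕ
open import Data.Nat.ListAction using () renaming (sum to sumˡ)
open import Data.Nat.Properties hiding (_≟_; suc-injective)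
open import Data.Product using (∃; ∃₂; _×_; _,_; proj₁; proj₂)
open import Data.Sum using (_⊎_; inj₁; inj₂)
open import Function using (_∘_; id; Equivalence)
open import Relation.Binary.PropositionalEquality
open import Relation.Nullary using (Dec; does; yes; no; ¬_; ¬?; _×-dec_; _⊎-dec_; _→-dec_)
open import Relation.Nullary.Decidable using (dec-true)
open import Relation.Unary using (Pred; Decidable)
open import Algebra.Properties.CommutativeMonoid.Sum +-0-commutativeMonoid
  using (sum; sum-syntax; sum-cong-≗; sum-replicate-zero; ∑-distrib-+; ∑-comm)

open Equivalence using (to; from)

-- Finite sums and counting

ind : Bool → ℕ
ind b = if b then 1 else 0

ind≤1 : ∀ b → ind b ≤ 1
ind≤1 true  = ≤-refl
ind≤1 false = z≤n

count : ∀ {n} → (Fin n → Bool) → ℕ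
count {n} P = ∑[ v < n ] ind (P v)

sumˡ-allFin : ∀ {n} (g : Fin n → ℕ) → sumˡ (map g (allFin n)) ≡ sum g
sumˡ-allFin g = trans (cong sumˡ (map-tabulate id g)) (sumˡ-tabulate g)
  where
  sumˡ-tabulate : ∀ {m} (h : Fin m → ℕ) → sumˡ (tabulate h) ≡ sum h
  sumˡ-tabulate {zero}  h = refl
  sumˡ-tabulate {suc m} h = cong (h zero +_) (sumˡ-tabulate (h ∘ suc))

cost≡sum : ∀ {n} (f : Broadcast {n}) → cost f ≡ sum f
cost≡sum = sumˡ-allFin

card≡count : ∀ {n} (A : VSet {n}) → card A ≡ count A
card≡count A = sumˡ-allFin (ind ∘ A)

sum-ones : ∀ k → ∑[ i < k ] 1 ≡ k
sum-ones zero    = refl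
sum-ones (suc k) = cong suc (sum-ones k)

sum-mono-≤ : ∀ {n} {g h : Fin n → ℕ} → (∀ v → g v ≤ h v) → sum g ≤ sum h
sum-mono-≤ {zero}  g≤h = z≤n
sum-mono-≤ {suc n} g≤h = +-mono-≤ (g≤h zero) (sum-mono-≤ (g≤h ∘ suc))

sum-mono-< : ∀ {n} {g h : Fin n → ℕ} → (∀ v → g v ≤ h v) → ∀ x → g x < h x → sum g < sum h
sum-mono-< {suc n} g≤h zero    gx<hx = +-mono-<-≤ gx<hx (sum-mono-≤ (g≤h ∘ suc))
sum-mono-< {suc n} g≤h (suc x) gx<hx = +-mono-≤-< (g≤h zero) (sum-mono-< (g≤h ∘ suc) x gx<hx)

term≤sum : ∀ {n} (g : Fin n → ℕ) x → g x ≤ sum g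
term≤sum g zero    = m≤m+n _ _
term≤sum g (suc x) = ≤-trans (term≤sum (g ∘ suc) x) (m≤n+m _ _)

two-terms≤sum : ∀ {n} (g : Fin n → ℕ) {x y} → x ≢ y → g x + g y ≤ sum g
two-terms≤sum g {zero}  {zero}  x≢y = ⊥-elim (x≢y refl)
two-terms≤sum g {zero}  {suc y} _   = +-monoʳ-≤ (g zero) (term≤sum (g ∘ suc) y)
two-terms≤sum g {suc x} {zero}  _   =
  subst (_≤ sum g) (+-comm (g zero) (g (suc x))) (+-monoʳ-≤ (g zero) (term≤sum (g ∘ suc) x))
two-terms≤sum g {suc x} {suc y} x≢y =
  ≤-trans (two-terms≤sum (g ∘ suc) (x≢y ∘ cong suc)) (m≤n+m _ _)

∑²-distrib-+ : ∀ {n} (a b : Fin n → Fin n → ℕ) →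
  ∑[ u < n ] ∑[ v < n ] (a u v + b u v) ≡ ∑[ u < n ] ∑[ v < n ] a u v + ∑[ u < n ] ∑[ v < n ] b u v
∑²-distrib-+ {n} a b = trans (sum-cong-≗ (λ u → ∑-distrib-+ (a u) (b u)))
                             (∑-distrib-+ (λ u → ∑[ v < n ] a u v) (λ u → ∑[ v < n ] b u v))

count≤n : ∀ {n} (P : Fin n → Bool) → count P ≤ n
count≤n {n} P = ≤-trans (sum-mono-≤ (ind≤1 ∘ P)) (≤-reflexive (sum-ones n))

count-≤1 : ∀ {n} (P : Fin n → Bool) → (∀ u v → P u ≡ true → P v ≡ true → u ≡ v) → count P ≤ 1
count-≤1 {zero}  P unique = z≤n
count-≤1 {suc n} P unique with P zero in P0
... | true  = s≤s (≤-trans (sum-mono-≤ others-false) (≤-reflexive (sum-replicate-zero n)))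
  where
  others-false : ∀ v → ind (P (suc v)) ≤ 0
  others-false v with P (suc v) in Pv
  ... | false = z≤n
  ... | true  with () ← unique zero (suc v) P0 Pv
... | false = count-≤1 (P ∘ suc) (λ u v Pu Pv → Fin.suc-injective (unique (suc u) (suc v) Pu Pv))

two≤count : ∀ {n} (P : Fin n → Bool) {x y} → x ≢ y → P x ≡ true → P y ≡ true → 2 ≤ count P
two≤count P x≢y Px Py =
  subst₂ (λ a b → ind a + ind b ≤ count P) Px Py (two-terms≤sum (ind ∘ P) x≢y)

count-∨ : ∀ {n} (P Q : Fin n → Bool) → count (λ v → P v ∨ Q v) ≤ count P + count Q
count-∨ P Q =
  ≤-trans (sum-mono-≤ (λ v → ind-∨ (P v) (Q v))) (≤-reflexive (∑-distrib-+ (ind ∘ P) (ind ∘ Q)))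
  where
  ind-∨ : ∀ a b → ind (a ∨ b) ≤ ind a + ind b
  ind-∨ true  b = s≤s z≤n
  ind-∨ false b = ≤-refl

count-≢ : ∀ {n} (r : Fin n) → count (λ v → not (does (v ≟ r))) + 1 ≡ n
count-≢ {suc n} zero    = trans (+-comm (∑[ v < n ] 1) 1) (cong suc (sum-ones n))
count-≢ {suc n} (suc r) = cong suc (count-≢ r)

count≤∑-labels : ∀ {n m} (P : Fin n → Bool) (g : Fin m → ℕ)
  (L : Fin n → (z : Fin m) → Fin (g z) → Bool) →
  (∀ v → P v ≡ true → ∃₂ λ z i → L v z i ≡ true) →
  (∀ z i u v → L u z i ≡ true → L v z i ≡ true → u ≡ v) →
  count P ≤ ∑[ z < m ] g z
count≤∑-labels {n} {m} P g L labelled injective = begin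
  count P                                           ≤⟨ sum-mono-≤ one≤labels ⟩
  ∑[ v < n ] ∑[ z < m ] ∑[ i < g z ] ind (L v z i) ≡⟨ ∑-comm (λ v z → ∑[ i < g z ] ind (L v z i)) ⟩
  ∑[ z < m ] ∑[ v < n ] ∑[ i < g z ] ind (L v z i) ≡⟨ sum-cong-≗ (λ z → ∑-comm λ v i → ind (L v z i)) ⟩
  ∑[ z < m ] ∑[ i < g z ] count (λ v → L v z i)   ≤⟨ sum-mono-≤ (λ z → sum-mono-≤ (λ i →
                                                         count-≤1 (λ v → L v z i) (injective z i))) ⟩
  ∑[ z < m ] ∑[ i < g z ] 1                        ≡⟨ sum-cong-≗ (sum-ones ∘ g) ⟩
  ∑[ z < m ] g z                                    ∎
  where
  open ≤-Reasoning
  one≤labels : ∀ v → ind (P v) ≤ ∑[ z < m ] ∑[ i < g z ] ind (L v z i)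
  one≤labels v with P v in Pv
  ... | false = z≤n
  ... | true with z , i , Lvzi ← labelled v Pv = begin
    1                                      ≡⟨ cong ind Lvzi ⟨
    ind (L v z i)                          ≤⟨ term≤sum (λ i → ind (L v z i)) i ⟩
    ∑[ i < g z ] ind (L v z i)             ≤⟨ term≤sum (λ z → ∑[ i < g z ] ind (L v z i)) z ⟩
    ∑[ z < m ] ∑[ i < g z ] ind (L v z i)  ∎

∃-minimal : ∀ {n ℓ} {P : Pred (Fin n) ℓ} → Decidable P → (μ : Fin n → ℕ) → ∃ P →
  ∃ λ z → P z × ∀ z′ → P z′ → μ z ≤ μ z′
∃-minimal {P = P} P? μ (z , Pz) = descend (μ z) z Pz ≤-refl
  where
  descend : ∀ b z → P z → μ z ≤ b → ∃ λ z → P z × ∀ z′ → P z′ → μ z ≤ μ z′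
  descend b z Pz μz≤b with any? (λ z′ → P? z′ ×-dec μ z′ <? μ z)
  ... | no ∄smaller = z , Pz , λ z′ Pz′ → ≮⇒≥ (λ μz′<μz → ∄smaller (z′ , Pz′ , μz′<μz))
  ... | yes (z′ , Pz′ , μz′<μz) with b
  ...   | zero  = ⊥-elim (n≮0 (≤-trans μz′<μz μz≤b))
  ...   | suc b = descend b z′ Pz′ (≤-pred (≤-trans μz′<μz μz≤b))

-- Walks and truncated distances

any-allFin⁺ : ∀ {n} (p : Fin n → Bool) {v} → p v ≡ true → any p (allFin n) ≡ true
any-allFin⁺ p {v} pv = to T-≡ (Any.any⁺ p (lose (∈-allFin v) (from T-≡ pv)))

any-allFin⁻ : ∀ {n} (p : Fin n → Bool) → any p (allFin n) ≡ true → ∃ λ v → p v ≡ true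
any-allFin⁻ {n} p anyp with v , pv ← satisfied (Any.any⁻ p (allFin n) (from T-≡ anyp)) = v , to T-≡ pv

UniqueParents : ∀ {n} → Digraph n → Set
UniqueParents G = ∀ {p q v} → G p v ≡ true → G q v ≡ true → p ≡ q

module WalkTheory {n : ℕ} (G : Digraph n) where

  infixl 5 _▷_

  data Walk (u : Fin n) : Fin n → ℕ → Set where
    []  : Walk u u 0
    _▷_ : ∀ {w v i} → Walk u w i → G w v ≡ true → Walk u v (suc i)

  walk⇒reach : ∀ {u v i j} → Walk u v i → i ≤ j → reach G j u v ≡ true
  walk⇒reach {u}     {j = zero}  []      z≤n       = dec-true (u ≟ u) refl
  walk⇒reach {u}     {j = suc j} []      z≤n       rewrite walk⇒reach {u} {j = j} [] z≤n = refl
  walk⇒reach {u} {v} {j = suc j} (p ▷ e) (s≤s i≤j) =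
    trans (cong (reach G j u v ∨_)
                (any-allFin⁺ (λ w → reach G j u w ∧ G w v) (cong₂ _∧_ (walk⇒reach p i≤j) e)))
          (∨-zeroʳ _)

  reach-self : ∀ j u → reach G j u u ≡ true
  reach-self j u = walk⇒reach {u} {j = j} [] z≤n

  reach⇒walk : ∀ j {u v} → reach G j u v ≡ true → ∃ λ i → i ≤ j × Walk u v i
  reach⇒walk zero {u} {v} r with u ≟ v
  reach⇒walk zero r  | yes refl = 0 , z≤n , []
  reach⇒walk zero () | no _
  reach⇒walk (suc j) {u} {v} r with reach G j u v in r′
  ... | true  with i , i≤j , p ← reach⇒walk j r′ = i , m≤n⇒m≤1+n i≤j , p
  ... | false with w , r∧e ← any-allFin⁻ (λ w → reach G j u w ∧ G w v) r
    with i , i≤j , p ← reach⇒walk j (∧-conicalˡ _ _ r∧e)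
    = suc i , s≤s i≤j , p ▷ ∧-conicalʳ _ _ r∧e

  module _ (u v : Fin n) where

    searchDist-≤ : ∀ j m → searchDist G u v j m ≤ j + m
    searchDist-≤ j zero    = ≤-reflexive (sym (+-identityʳ j))
    searchDist-≤ j (suc m) with reach G j u v
    ... | true  = m≤m+n j (suc m)
    ... | false = ≤-trans (searchDist-≤ (suc j) m) (≤-reflexive (sym (+-suc j m)))

    searchDist-reach : ∀ j m → searchDist G u v j m < j + m → reach G (searchDist G u v j m) u v ≡ true
    searchDist-reach j zero    d<j+0   = ⊥-elim (<-irrefl (sym (+-identityʳ j)) d<j+0)
    searchDist-reach j (suc m) d<j+1+m with reach G j u v in r
    ... | true  = r
    ... | false = searchDist-reach (suc j) m (subst (searchDist G u v (suc j) m <_) (+-suc j m) d<j+1+m)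

    searchDist-least : ∀ j m i → reach G i u v ≡ true → j ≤ i → i < j + m → searchDist G u v j m ≤ i
    searchDist-least j zero    i _ j≤i i<j+0 =
      ⊥-elim (<-irrefl refl (≤-trans i<j+0 (≤-trans (≤-reflexive (+-identityʳ j)) j≤i)))
    searchDist-least j (suc m) i r j≤i i<j+1+m with reach G j u v in r′
    ... | true  = j≤i
    ... | false with m≤n⇒m<n∨m≡n j≤i
    ...   | inj₂ refl with () ← trans (sym r) r′
    ...   | inj₁ j<i  = searchDist-least (suc j) m i r j<i (subst (i <_) (+-suc j m) i<j+1+m)

  module _ {k : ℕ} {u v : Fin n} where

    dtr-≤ : dtr G k u v ≤ suc k
    dtr-≤ = searchDist-≤ u v 0 (suc k)

    walk⇒dtr-≤ : ∀ {i} → Walk u v i → i ≤ k → dtr G k u v ≤ i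
    walk⇒dtr-≤ p i≤k = searchDist-least u v 0 (suc k) _ (walk⇒reach p ≤-refl) z≤n (s≤s i≤k)

    dtr-walk : dtr G k u v ≤ k → Walk u v (dtr G k u v)
    dtr-walk d≤k with i , i≤d , p ← reach⇒walk _ (searchDist-reach u v 0 (suc k) (s≤s d≤k)) =
      subst (Walk u v) (≤-antisym i≤d (walk⇒dtr-≤ p (≤-trans i≤d d≤k))) p

    dtr-≰⇒≡suc : ¬ dtr G k u v ≤ k → dtr G k u v ≡ suc k
    dtr-≰⇒≡suc d≰k = ≤-antisym dtr-≤ (≰⇒> d≰k)

  dtr-self : ∀ k u → dtr G k u u ≡ 0
  dtr-self k u = n≤0⇒n≡0 (walk⇒dtr-≤ {k} {u} [] z≤n)

  dtr-≢0 : ∀ k {u v} → u ≢ v → dtr G k u v ≢ 0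
  dtr-≢0 k {u} {v} u≢v d≡0 with subst (Walk u v) d≡0 (dtr-walk {k} (subst (_≤ k) (sym d≡0) z≤n))
  ... | [] = u≢v refl

  dtr-self-separates : ∀ k {x y} → x ≢ y → dtr G k x x ≢ dtr G k x y
  dtr-self-separates k {x} x≢y eq = dtr-≢0 k x≢y (trans (sym eq) (dtr-self k x))

  dtr-≤-by-walks : ∀ k {u v u′ v′} → (∀ i → i ≤ k → Walk u v i → Walk u′ v′ i) →
    dtr G k u′ v′ ≤ dtr G k u v
  dtr-≤-by-walks k {u} {v} transfer with dtr G k u v ≤? k
  ... | yes d≤k = walk⇒dtr-≤ (transfer _ d≤k (dtr-walk d≤k)) d≤k
  ... | no  d≰k = ≤-trans dtr-≤ (≤-reflexive (sym (dtr-≰⇒≡suc d≰k)))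

  dtr-cong-walks : ∀ k {u v u′ v′} →
    (∀ i → i ≤ k → Walk u v i → Walk u′ v′ i) →
    (∀ i → i ≤ k → Walk u′ v′ i → Walk u v i) →
    dtr G k u v ≡ dtr G k u′ v′
  dtr-cong-walks k there back = ≤-antisym (dtr-≤-by-walks k back) (dtr-≤-by-walks k there)

  walk₁⇒arc : ∀ {u v} → Walk u v 1 → G u v ≡ true
  walk₁⇒arc ([] ▷ e) = e

  arc⇒dtr₁≡1 : ∀ {u v} → u ≢ v → G u v ≡ true → dtr G 1 u v ≡ 1
  arc⇒dtr₁≡1 u≢v e = ≤-antisym (walk⇒dtr-≤ ([] ▷ e) ≤-refl) (n≢0⇒n>0 (dtr-≢0 1 u≢v))

  dtr₁≡1⇒arc : ∀ {u v} → dtr G 1 u v ≡ 1 → G u v ≡ true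
  dtr₁≡1⇒arc d≡1 = walk₁⇒arc (subst (Walk _ _) d≡1 (dtr-walk (≤-reflexive d≡1)))

  _++ʷ_ : ∀ {u w v a j} → Walk u w a → Walk w v j → Walk u v (j + a)
  p ++ʷ []      = p
  p ++ʷ (q ▷ e) = (p ++ʷ q) ▷ e

  walk-split : ∀ j {a u v} → Walk u v (j + a) → ∃ λ w → Walk u w a × Walk w v j
  walk-split zero    p       = _ , p , []
  walk-split (suc j) (p ▷ e) with w , q , r ← walk-split j p = w , q , r ▷ e

  module _ (unique : UniqueParents G) where

    walk-source-unique : ∀ {u u′ v i} → Walk u v i → Walk u′ v i → u ≡ u′
    walk-source-unique []      []        = refl
    walk-source-unique (p ▷ e) (p′ ▷ e′) with refl ← unique e e′ = walk-source-unique p p′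

    -- A walk of length i ≥ j into v passes through the unique vertex at distance j above v.
    walk-transfer : ∀ {z v v′ w i j} → Walk z v j → Walk z v′ j → Walk w v i → j ≤ i → Walk w v′ i
    walk-transfer zv zv′ wv j≤i
      with y , wy , yv ← walk-split _ (subst (Walk _ _) (sym (m+[n∸m]≡n j≤i)) wv)
      with refl ← walk-source-unique yv zv
      = subst (Walk _ _) (m+[n∸m]≡n j≤i) (wy ++ʷ zv′)

    siblings-equidistant : ∀ {p x y z} → G p x ≡ true → G p y ≡ true →
      z ≢ x → z ≢ y → ∀ k → dtr G k z x ≡ dtr G k z y
    siblings-equidistant Gpx Gpy z≢x z≢y k =
      dtr-cong-walks k (λ _ _ → move Gpx Gpy z≢x) (λ _ _ → move Gpy Gpx z≢y)
      where
      move : ∀ {p x y z i} → G p x ≡ true → G p y ≡ true → z ≢ x → Walk z x i → Walk z y i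
      move _   _   z≢x []         = ⊥-elim (z≢x refl)
      move Gpx Gpy _   w@(_ ▷ _) = walk-transfer ([] ▷ Gpx) ([] ▷ Gpy) w (s≤s z≤n)

-- Reachability saturates within n steps

module _ {n : ℕ} (G : Digraph n) (u : Fin n) where

  open WalkTheory G

  Stable : ℕ → Set
  Stable m = ∀ v → reach G (suc m) u v ≡ true → reach G m u v ≡ true

  stable-at? : ∀ m v → Dec (reach G (suc m) u v ≡ true → reach G m u v ≡ true)
  stable-at? m v = (reach G (suc m) u v Bool.≟ true) →-dec (reach G m u v Bool.≟ true)

  stable⇒reach : ∀ m {v i} → Stable m → Walk u v i → reach G m u v ≡ true
  stable⇒reach m st []      = reach-self m u
  stable⇒reach m st (p ▷ e) with i , i≤m , q ← reach⇒walk m (stable⇒reach m st p) =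
    st _ (walk⇒reach (q ▷ e) (s≤s i≤m))

  -- Until the ball around u stabilises, it gains a vertex at every step.
  reach-grows : ∀ m → (∃ λ m′ → m′ ≤ m × Stable m′) ⊎ (suc m ≤ count (reach G m u))
  reach-grows zero =
    inj₂ (≤-trans (≤-reflexive (cong ind (sym (reach-self 0 u)))) (term≤sum (ind ∘ reach G 0 u) u))
  reach-grows (suc m) with reach-grows m
  ... | inj₁ (m′ , m′≤m , st) = inj₁ (m′ , m≤n⇒m≤1+n m′≤m , st)
  ... | inj₂ m<count with all? (stable-at? m)
  ...   | yes st  = inj₁ (m , n≤1+n m , st)
  ...   | no  ¬st with v , new ← ¬∀⟶∃¬ n _ (stable-at? m) ¬st =
    inj₂ (≤-trans (s≤s m<count) (sum-mono-< (λ w → ind-∨ˡ (reach G m u w)) v (grows-at new)))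
    where
    ind-∨ˡ : ∀ a {b} → ind a ≤ ind (a ∨ b)
    ind-∨ˡ true  = ≤-refl
    ind-∨ˡ false = z≤n
    grows-at : ∀ {a b} → ¬ (a ≡ true → b ≡ true) → ind b < ind a
    grows-at {true}  {false} _   = ≤-refl
    grows-at {true}  {true}  new = ⊥-elim (new (λ _ → refl))
    grows-at {false}         new = ⊥-elim (new (λ ()))

  reachable⇒short-walk : ∀ {v} → Reachable G u v → ∃ λ i → i ≤ n × Walk u v i
  reachable⇒short-walk (j , r) with reach-grows n
  ... | inj₂ n<count = ⊥-elim (<-irrefl refl (≤-trans n<count (count≤n _)))
  ... | inj₁ (m , m≤n , st)
    with i , i≤m , p ← reach⇒walk m (stable⇒reach m st (proj₂ (proj₂ (reach⇒walk j r))))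
    = i , ≤-trans i≤m m≤n , p

-- Out-trees have unique parents

<ᵇ-flip : ∀ m n → m ≢ n → (m <ᵇ n) ≡ not (n <ᵇ m)
<ᵇ-flip zero    zero    m≢n = ⊥-elim (m≢n refl)
<ᵇ-flip zero    (suc n) _   = refl
<ᵇ-flip (suc m) zero    _   = refl
<ᵇ-flip (suc m) (suc n) m≢n = <ᵇ-flip m n (m≢n ∘ cong suc)

ind-∧-split : ∀ a b e → (e ≡ true → a ≡ not b) → ind e ≡ ind (a ∧ e) + ind (b ∧ e)
ind-∧-split a     b     false _    rewrite ∧-zeroʳ a | ∧-zeroʳ b = refl
ind-∧-split true  false true  _    = refl
ind-∧-split false true  true  _    = refl
ind-∧-split true  true  true  a≡¬b with () ← a≡¬b refl
ind-∧-split false false true  a≡¬b with () ← a≡¬b refl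

ind-∧-∨ : ∀ a x y → (x ≡ true → y ≡ false) → ind (a ∧ (x ∨ y)) ≡ ind (a ∧ x) + ind (a ∧ y)
ind-∧-∨ false x     y     _     = refl
ind-∧-∨ true  false y     _     = refl
ind-∧-∨ true  true  false _     = refl
ind-∧-∨ true  true  true  x⇒¬y with () ← x⇒¬y refl

module _ {n : ℕ} (E : Digraph n) where

  indegree : Fin n → ℕ
  indegree v = count (λ p → E p v)

  arc⇒≢ : Loopless E → ∀ {u v} → E u v ≡ true → u ≢ v
  arc⇒≢ loopless Euv refl with () ← trans (sym Euv) (loopless _)

  private
    lt : Fin n → Fin n → Bool
    lt u v = toℕ u <ᵇ toℕ v

  ∑indegree≡undirEdgeCount : Loopless E → (∀ {u v} → E u v ≡ true → E v u ≡ false) →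
    ∑[ v < n ] indegree v ≡ undirEdgeCount E
  ∑indegree≡undirEdgeCount loopless asym = begin
    ∑[ v < n ] ∑[ u < n ] ind (E u v)
      ≡⟨ ∑-comm (λ v u → ind (E u v)) ⟩
    ∑[ u < n ] ∑[ v < n ] ind (E u v)
      ≡⟨ sum-cong-≗ (λ u → sum-cong-≗ (λ v → ind-∧-split _ _ (E u v) (order-split u v))) ⟩
    ∑[ u < n ] ∑[ v < n ] (ind (lt u v ∧ E u v) + ind (lt v u ∧ E u v))
      ≡⟨ ∑²-distrib-+ (λ u v → ind (lt u v ∧ E u v)) (λ u v → ind (lt v u ∧ E u v)) ⟩
    ∑[ u < n ] ∑[ v < n ] ind (lt u v ∧ E u v) + ∑[ u < n ] ∑[ v < n ] ind (lt v u ∧ E u v)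
      ≡⟨ cong (∑[ u < n ] ∑[ v < n ] ind (lt u v ∧ E u v) +_)
              (∑-comm (λ u v → ind (lt v u ∧ E u v))) ⟩
    ∑[ u < n ] ∑[ v < n ] ind (lt u v ∧ E u v) + ∑[ u < n ] ∑[ v < n ] ind (lt u v ∧ E v u)
      ≡⟨ ∑²-distrib-+ (λ u v → ind (lt u v ∧ E u v)) (λ u v → ind (lt u v ∧ E v u)) ⟨
    ∑[ u < n ] ∑[ v < n ] (ind (lt u v ∧ E u v) + ind (lt u v ∧ E v u))
      ≡⟨ sum-cong-≗ (λ u → sum-cong-≗ (λ v → ind-∧-∨ (lt u v) (E u v) (E v u) asym)) ⟨
    ∑[ u < n ] ∑[ v < n ] ind (lt u v ∧ undirected E u v)
      ≡⟨ trans (sumˡ-allFin undirEdges-from)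
               (sum-cong-≗ (λ u → sumˡ-allFin (λ v → ind (lt u v ∧ undirected E u v)))) ⟨
    undirEdgeCount E ∎
    where
    open ≡-Reasoning
    undirEdges-from : Fin n → ℕ
    undirEdges-from u = sumˡ (map (λ v → ind (lt u v ∧ undirected E u v)) (allFin n))
    order-split : ∀ u v → E u v ≡ true → lt u v ≡ not (lt v u)
    order-split u v Euv = <ᵇ-flip (toℕ u) (toℕ v) (arc⇒≢ loopless Euv ∘ toℕ-injective)

module _ {n : ℕ} {E : Digraph n} {r : Fin n} (tree : IsOutTree E r) where

  private
    U = undirected E
    away : ∀ u v → E u v ≡ true → dtr U n r u < dtr U n r v
    away = proj₂ (proj₂ tree)

  open WalkTheory U

  dtr-root-≤ : ∀ v → dtr U n r v ≤ n
  dtr-root-≤ v with i , i≤n , p ← reachable⇒short-walk U r (proj₁ (proj₁ (proj₂ tree)) r v) =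
    ≤-trans (walk⇒dtr-≤ p i≤n) i≤n

  has-parent : ∀ {v} → v ≢ r → ∃ λ p → E p v ≡ true
  has-parent {v} v≢r = last-arc v≢r (dtr-walk (dtr-root-≤ v)) ≤-refl
    where
    last-arc : ∀ {v i} → v ≢ r → Walk r v i → i ≤ dtr U n r v → ∃ λ p → E p v ≡ true
    last-arc r≢r [] _ = ⊥-elim (r≢r refl)
    last-arc {v} _ (_▷_ {w} p e) i<d with E w v in Ewv
    ... | true  = w , Ewv
    ... | false = ⊥-elim (<-asym (away v w e)
                    (≤-<-trans (walk⇒dtr-≤ p (≤-trans (n≤1+n _) (≤-trans i<d (dtr-root-≤ v)))) i<d))

  outTree-uniqueParents : UniqueParents E
  outTree-uniqueParents {p} {q} {x} Epx Eqx with p ≟ q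
  ... | yes p≡q = p≡q
  ... | no  p≢q = ⊥-elim (<-irrefl refl (begin-strict
    n                                     ≡⟨ count-≢ r ⟨
    count (λ v → not (does (v ≟ r))) + 1  <⟨ +-monoˡ-< 1 (sum-mono-< non-root≤indegree x
                                                (≤-<-trans (ind≤1 _) two≤indegree)) ⟩
    ∑[ v < n ] indegree E v + 1           ≡⟨ cong (_+ 1) (∑indegree≡undirEdgeCount E (proj₁ tree) asym) ⟩
    undirEdgeCount E + 1                  ≡⟨ proj₂ (proj₁ (proj₂ tree)) ⟩
    n                                     ∎))
    where
    open ≤-Reasoning
    two≤indegree : 2 ≤ indegree E x
    two≤indegree = two≤count (λ u → E u x) p≢q Epx Eqx
    asym : ∀ {u v} → E u v ≡ true → E v u ≡ false
    asym {u} {v} Euv with E v u in Evu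
    ... | false = refl
    ... | true  = ⊥-elim (<-asym (away u v Euv) (away v u Evu))
    non-root≤indegree : ∀ v → ind (not (does (v ≟ r))) ≤ indegree E v
    non-root≤indegree v with v ≟ r
    ... | yes _   = z≤n
    ... | no  v≢r with u , Euv ← has-parent v≢r =
      subst (λ b → ind b ≤ indegree E v) Euv (term≤sum (λ u → ind (E u v)) u)

-- From a resolving broadcast to an adjacency resolving set

from-does : ∀ {a} {A : Set a} (a? : Dec A) → does a? ≡ true → A
from-does (yes a) _ = a

index-from-2 : ∀ {d k} → 2 ≤ d → d ≤ k → ∃ λ (i : Fin (k ∸ 1)) → d ≡ 2 + toℕ i
index-from-2 {suc (suc d)} (s≤s (s≤s _)) d≤k =
  fromℕ< (∸-monoˡ-≤ 1 d≤k) , cong (2 +_) (sym (toℕ-fromℕ< _))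

ind-pos+pred : ∀ m → ind (does (0 <? m)) + (m ∸ 1) ≡ m
ind-pos+pred zero    = refl
ind-pos+pred (suc m) = refl

module FromBroadcast {n : ℕ} (E : Digraph n) (f : Broadcast {n}) where

  open WalkTheory E

  Active : Fin n → Set
  Active z = 0 < f z

  active? : ∀ z → Dec (Active z)
  active? z = 0 <? f z

  δ : Fin n → Fin n → ℕ
  δ z v = dtr E (f z) z v

  HasActiveParent : Fin n → Set
  HasActiveParent v = ∃ λ p → E p v ≡ true × Active p

  hasActiveParent? : ∀ v → Dec (HasActiveParent v)
  hasActiveParent? v = any? λ p → (E p v Bool.≟ true) ×-dec active? p

  Hidden : Fin n → Set
  Hidden v = ¬ Active v × ¬ HasActiveParent v

  Covers : Fin n → Fin n → Set
  Covers z v = Active z × δ z v ≤ f z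

  covers? : ∀ z v → Dec (Covers z v)
  covers? z v = active? z ×-dec δ z v ≤? f z

  Spotted : Fin n → Set
  Spotted v = Hidden v × ∃ λ z → Covers z v

  spotted? : ∀ v → Dec (Spotted v)
  spotted? v = (¬? (active? v) ×-dec ¬? (hasActiveParent? v)) ×-dec any? (λ z → covers? z v)

  NearestCoverer : Fin n → Fin n → Set
  NearestCoverer z v = Covers z v × ∀ z′ → Covers z′ v → δ z v ≤ δ z′ v

  Label : Fin n → (z : Fin n) → Fin (f z ∸ 1) → Set
  Label v z i = NearestCoverer z v × δ z v ≡ 2 + toℕ i

  label? : ∀ v z i → Dec (Label v z i)
  label? v z i = (covers? z v ×-dec all? (λ z′ → covers? z′ v →-dec δ z v ≤? δ z′ v))
                 ×-dec δ z v ℕ.≟ 2 + toℕ i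

  resolvingSet : VSet
  resolvingSet v = does (active? v ⊎-dec spotted? v)

  hidden⇒far : ∀ {z v i} → Hidden v → Active z → Walk z v i → 2 ≤ i
  hidden⇒far (inactive , _)         active-z []           = ⊥-elim (inactive active-z)
  hidden⇒far (_ , no-active-parent) active-z ([] ▷ e)     = ⊥-elim (no-active-parent (_ , e , active-z))
  hidden⇒far _                      _        (_ ▷ _ ▷ _)  = s≤s (s≤s z≤n)

  label-exists : ∀ {v} → Spotted v → ∃₂ λ z i → Label v z i
  label-exists {v} (hidden , covered)
    with z , (active-z , δ≤f) , nearest ← ∃-minimal (λ z → covers? z v) (λ z → δ z v) covered
    with i , δ≡2+i ← index-from-2 (hidden⇒far hidden active-z (dtr-walk δ≤f)) δ≤f
    = z , i , ((active-z , δ≤f) , nearest) , δ≡2+i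

  outside⇒parent-or-far : ∀ {v} → ¬ (Active v ⊎ Spotted v) →
    HasActiveParent v ⊎ (∀ z → Active z → δ z v ≡ suc (f z))
  outside⇒parent-or-far {v} v∉ with hasActiveParent? v
  ... | yes has-parent = inj₁ has-parent
  ... | no  no-parent  = inj₂ λ z active-z →
    dtr-≰⇒≡suc λ δ≤f → v∉ (inj₂ ((v∉ ∘ inj₁ , no-parent) , z , active-z , δ≤f))

  module _ (unique : UniqueParents E) (resolving : Resolving E f) where

    label-unique : ∀ {u v z i} → Label u z i → Label v z i → u ≡ v
    label-unique {u} {v} {z} (nearest-u , δu) (nearest-v , δv) with u ≟ v
    ... | yes u≡v = u≡v
    ... | no  u≢v with w , active-w , separates ← resolving u v u≢v =
      ⊥-elim (separates (dtr-cong-walks (f w) (transfer nearest-u nearest-v (trans δu (sym δv)))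
                                               (transfer nearest-v nearest-u (trans δv (sym δu)))))
      where
      transfer : ∀ {x y} → NearestCoverer z x → NearestCoverer z y → δ z x ≡ δ z y →
        ∀ i → i ≤ f w → Walk w x i → Walk w y i
      transfer {x} ((_ , δx≤f) , nearest) ((_ , δy≤f) , _) δx≡δy i i≤fw wx with δ z x ≤? i
      ... | yes δx≤i =
        walk-transfer unique (dtr-walk δx≤f) (subst (Walk z _) (sym δx≡δy) (dtr-walk δy≤f)) wx δx≤i
      ... | no  δx≰i = ⊥-elim (δx≰i (≤-trans (nearest w (active-w , ≤-trans δwx≤i i≤fw)) δwx≤i))
        where
        δwx≤i : δ w x ≤ i
        δwx≤i = walk⇒dtr-≤ wx i≤fw

    card-resolvingSet : card resolvingSet ≤ cost f
    card-resolvingSet = begin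
      card resolvingSet
        ≡⟨ card≡count resolvingSet ⟩
      count resolvingSet
        ≤⟨ count-∨ (does ∘ active?) (does ∘ spotted?) ⟩
      count (does ∘ active?) + count (does ∘ spotted?)
        ≤⟨ +-monoʳ-≤ (count (does ∘ active?)) spotted-count ⟩
      count (does ∘ active?) + ∑[ z < n ] (f z ∸ 1)
        ≡⟨ ∑-distrib-+ (ind ∘ does ∘ active?) (λ z → f z ∸ 1) ⟨
      ∑[ z < n ] (ind (does (active? z)) + (f z ∸ 1))
        ≡⟨ sum-cong-≗ (ind-pos+pred ∘ f) ⟩
      sum f
        ≡⟨ cost≡sum f ⟨
      cost f
        ∎
      where
      open ≤-Reasoning
      spotted-count : count (does ∘ spotted?) ≤ ∑[ z < n ] (f z ∸ 1)
      spotted-count = count≤∑-labels (does ∘ spotted?) (λ z → f z ∸ 1) (λ v z i → does (label? v z i))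
        (λ v spotted → let z , i , label = label-exists (from-does (spotted? v) spotted)
                       in z , i , dec-true (label? v z i) label)
        (λ z i u v Lu Lv → label-unique (from-does (label? u z i) Lu) (from-does (label? v z i) Lv))

    parent-separates : ∀ {p x y z} → E p x ≡ true → Active p → ¬ Active x → ¬ Active y → Active z →
      δ z x ≢ δ z y → dtr E 1 p x ≢ dtr E 1 p y
    parent-separates {z = z} Epx active-p inactive-x inactive-y active-z separates eq =
      separates (siblings-equidistant unique Epx Epy (λ { refl → inactive-x active-z })
                                                     (λ { refl → inactive-y active-z }) (f z))
      where
      Epy = dtr₁≡1⇒arc (trans (sym eq) (arc⇒dtr₁≡1 (λ { refl → inactive-x active-p }) Epx))

    resolvingSet-adjResolving : AdjResolving E resolvingSet
    resolvingSet-adjResolving x y x≢y with active? x ⊎-dec spotted? x | active? y ⊎-dec spotted? y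
    ... | yes x∈ | _      = x , dec-true (active? x ⊎-dec spotted? x) x∈ , dtr-self-separates 1 x≢y
    ... | no _   | yes y∈ =
      y , dec-true (active? y ⊎-dec spotted? y) y∈ , dtr-self-separates 1 (x≢y ∘ sym) ∘ sym
    ... | no x∉  | no y∉ with z , active-z , separates ← resolving x y x≢y
      with outside⇒parent-or-far x∉ | outside⇒parent-or-far y∉
    ...   | inj₁ (p , Epx , active-p) | _ =
      p , dec-true (active? p ⊎-dec spotted? p) (inj₁ active-p) ,
      parent-separates Epx active-p (x∉ ∘ inj₁) (y∉ ∘ inj₁) active-z separates
    ...   | inj₂ _ | inj₁ (p , Epy , active-p) =
      p , dec-true (active? p ⊎-dec spotted? p) (inj₁ active-p) ,
      parent-separates Epy active-p (y∉ ∘ inj₁) (x∉ ∘ inj₁) active-z (separates ∘ sym) ∘ sym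
    ...   | inj₂ far-x | inj₂ far-y =
      ⊥-elim (separates (trans (far-x z active-z) (sym (far-y z active-z))))

indicator : ∀ {n} → VSet {n} → Broadcast
indicator A v = ind (A v)

indicator-resolving : ∀ {n} {E : Digraph n} {A : VSet} → AdjResolving E A → Resolving E (indicator A)
indicator-resolving {E = E} adj x y x≢y with z , Az , separates ← adj x y x≢y =
  z , subst (λ b → 0 < ind b) (sym Az) ≤-refl ,
  subst (λ k → dtr E k z x ≢ dtr E k z y) (cong ind (sym Az)) separates

bdim≤adim : ∀ {n} {E : Digraph n} {a b} → IsAdim E a → IsBdim E b → b ≤ a
bdim≤adim ((A , adj , cardA≡a) , _) (_ , b-min) =
  ≤-trans (b-min (indicator A) (indicator-resolving adj)) (≤-reflexive cardA≡a)

adim≤bdim : ∀ {n} {E : Digraph n} {a b} → UniqueParents E → IsAdim E a → IsBdim E b → a ≤ b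
adim≤bdim {E = E} {a} {b} unique (_ , a-min) ((f , resolving , costf≡b) , _) = begin
  a                 ≤⟨ a-min resolvingSet (resolvingSet-adjResolving unique resolving) ⟩
  card resolvingSet ≤⟨ card-resolvingSet unique resolving ⟩
  cost f            ≡⟨ costf≡b ⟩
  b                 ∎
  where
  open FromBroadcast E f
  open ≤-Reasoning

theorem1p14 : (n : ℕ) (E : Digraph n) (r : Fin n) → IsOutTree E r →
    (a b : ℕ) → IsAdim E a → IsBdim E b → a ≡ b
theorem1p14 n E r tree a b adim bdim =
  ≤-antisym (adim≤bdim (outTree-uniqueParents tree) adim bdim) (bdim≤adim adim bdim)
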